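{- For every even integer $n \geq 12$, $r^{*}(P_3, C_n) \leq 2n-2$.
   Context: All graphs are finite and simple. $P_3$ is the path on $3$ vertices and $C_n$ is the cycle on $n$ vertices. For graphs $F,G,H$, we write $F \rightarrow (G,H)$ if for every $2$-coloring of the edges of $F$ with colors red and blue there is a red copy of $G$ or a blue copy of $H$ in $F$ (as subgraphs). The Ramsey number is $r(G,H)=\min\{|V(F)| : F \rightarrow (G,H)\}$, and the restricted size Ramsey number is $r^{*}(G,H)=\min\{|E(F)| : F \rightarrow (G,H),\ |V(F)|=r(G,H)\}$. -}

module Defs where

open import Data.Nat using (ℕ; zero; suc; _<_; _≤_; _<ᵇ_)
open import Data.Bool using (Bool; true; false; _∧_)
open import Data.Fin using (Fin; toℕ)
open import Data.List using (List; length; filterᵇ; cartesianProduct; allFin)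
open import Data.Product using (Σ; _×_; _,_; proj₁; proj₂; ∃)
open import Data.Sum using (_⊎_)
open import Relation.Binary.PropositionalEquality using (_≡_; _≢_)
open import Function.Definitions using (Injective)
open import Relation.Nullary using (¬_)

record Graph (N : ℕ) : Set where
  field
    adj   : Fin N → Fin N → Bool
    sym   : ∀ u v → adj u v ≡ adj v u
    irrefl : ∀ v → adj v v ≡ false
open Graph public

edgeCount : ∀ {N} → Graph N → ℕ
edgeCount {N} G =
  length (filterᵇ (λ p → (toℕ (proj₁ p) <ᵇ toℕ (proj₂ p)) ∧ adj G (proj₁ p) (proj₂ p))
                  (cartesianProduct (allFin N) (allFin N)))

data Colour : Set where
  red blue : Colour

-- A 2-colouring of the edges of G: a symmetric colour assignment to pairs
-- (values on non-edges are irrelevant).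
record Colouring {N : ℕ} (G : Graph N) : Set where
  field
    col    : Fin N → Fin N → Colour
    colSym : ∀ u v → col u v ≡ col v u
open Colouring public

ColEdge : ∀ {N} (G : Graph N) → Colouring G → Colour → Fin N → Fin N → Set
ColEdge G c k u v = (adj G u v ≡ true) × (col c u v ≡ k)

HasMonoP3 : ∀ {N} (G : Graph N) → Colouring G → Colour → Set
HasMonoP3 {N} G c k =
  Σ (Fin N) λ a → Σ (Fin N) λ b → Σ (Fin N) λ d →
    (a ≢ b) × (b ≢ d) × (a ≢ d) × ColEdge G c k a b × ColEdge G c k b d

-- A copy of C_n in colour k: an injective map f : Fin n → V(G) such that
-- consecutive vertices (indices i, i+1 mod n) are joined by edges of colour k.
CycleStep : ∀ {n} → Fin n → Fin n → Set
CycleStep {n} i j = (suc (toℕ i) ≡ toℕ j) ⊎ ((suc (toℕ i) ≡ n) × (toℕ j ≡ 0))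

HasMonoCycle : ∀ {N} (G : Graph N) → Colouring G → Colour → ℕ → Set
HasMonoCycle {N} G c k n =
  Σ (Fin n → Fin N) λ f → Injective _≡_ _≡_ f ×
    (∀ i j → CycleStep i j → ColEdge G c k (f i) (f j))

ArrowsP3Cycle : ∀ {N} → Graph N → ℕ → Set
ArrowsP3Cycle G n = ∀ (c : Colouring G) → HasMonoP3 G c red ⊎ HasMonoCycle G c blue n

IsRamseyP3Cycle : ℕ → ℕ → Set
IsRamseyP3Cycle n N =
  (Σ (Graph N) λ F → ArrowsP3Cycle F n) ×
  (∀ M → M < N → (F : Graph M) → ¬ ArrowsP3Cycle F n)

RestrictedSizeRamseyP3Cycle≤ : ℕ → ℕ → Set
RestrictedSizeRamseyP3Cycle≤ n m =
  Σ ℕ λ N → IsRamseyP3Cycle n N ×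
    Σ (Graph N) λ F → ArrowsP3Cycle F n × (edgeCount F ≤ m)

module Submission where

-- The graph F on n = 2k + 12 vertices is a ladder of k + 1 rungs {x_j, y_j}, consecutive rungs
-- spanning a K₂,₂, with a gadget attached to each of the two end rungs; the gadget is K₄,₃ minus
-- an edge, with the rung as two vertices of the larger side and five further private vertices.
-- So F has 4k + 22 = 2n − 2 edges.
-- In a colouring without a red P₃ the red edges form a matching.  Then each K₂,₂ contains a blue
-- perfect matching, and (by exhaustive check) each gadget contains a blue path between its rung
-- vertices through its five private vertices.  Following the matchings from the first rung to the
-- last and back again, closed up through the two gadgets, gives a blue Hamiltonian cycle.  Since
-- no graph on fewer than n vertices contains C_n at all, F also shows r(P₃, C_n) = n.

open import Defs hiding (sym)

open import Data.Bool using (Bool; true; false; T; not; _∧_; _∨_; _xor_; if_then_else_)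
open import Data.Bool.Properties using (∨-comm; T-∧; not-¬; not-distribˡ-xor)
open import Data.Empty using (⊥; ⊥-elim)
open import Data.Fin using (Fin; zero; suc; toℕ; fromℕ; inject₁; splitAt; _↑ˡ_; _↑ʳ_; combine; remQuot)
open import Data.Fin.Patterns using (0F; 1F; 2F; 3F; 4F; 5F; 6F)
open import Data.Fin.Properties using (_≟_; suc-injective; pigeonhole; splitAt-↑ˡ; splitAt-↑ʳ; splitAt⁻¹-↑ˡ; splitAt⁻¹-↑ʳ; remQuot-combine; 2↔Bool)
open import Data.List using (List; []; _∷_; [_]; _++_; length; lookup; reverse; reverseAcc; map; concatMap; filterᵇ; cartesianProduct; cartesianProductWith; allFin)
open import Data.List.Properties using (++-assoc; length-++; length-map; length-reverse; length-tabulate; map-++; reverse-++; unfold-reverse)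
open import Data.List.Membership.Propositional using (_∈_; _∉_)
open import Data.List.Membership.Propositional.Properties using (∈-lookup; ∈-++⁻; ∈-++⁺ˡ; ∈-++⁺ʳ; ∈-∃++; ∈-map⁺; ∈-filter⁺; ∈-filter⁻; ∈-allFin; ∈-concat⁺′; ∈-cartesianProductWith⁺; ∈-cartesianProduct⁺)
import Data.List.Membership.DecPropositional as DecMembership
open import Data.List.Relation.Binary.Permutation.Propositional using (↭⇒↭ₛ; ↭-sym)
open import Data.List.Relation.Binary.Permutation.Propositional.Properties using (↭-reverse; All-resp-↭)
import Data.List.Relation.Binary.Permutation.Setoid.Properties as Permutation
open import Data.List.Relation.Unary.All as All using (All; []; _∷_)
open import Data.List.Relation.Unary.All.Properties as All using ()
open import Data.List.Relation.Unary.AllPairs using ([]; _∷_)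
open import Data.List.Relation.Unary.Any as Any using (Any; here; there)
open import Data.List.Relation.Unary.Linked as Linked using (Linked; []; [-]; _∷_; linked?)
import Data.List.Relation.Unary.Linked.Properties as Linked
open import Data.List.Relation.Unary.Unique.Propositional using (Unique)
import Data.List.Relation.Unary.Unique.Propositional.Properties as Unique
open import Data.List.Relation.Unary.Unique.DecPropositional (_≟_ {7}) using (unique?)
open import Data.Nat using (ℕ; zero; suc; _+_; _*_; _∸_; _≤_; _<_; _<ᵇ_; z≤n; s≤s)
open import Data.Nat.Divisibility using (_∣_; divides)
open import Data.Nat.Tactic.RingSolver using (solve-∀)
import Data.Nat.Properties as ℕ
open import Data.Product using (Σ; _×_; _,_; proj₁; proj₂; uncurry)
import Data.Product as Product
open import Data.Product.Properties using (≡-dec)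
open import Data.Sum using (_⊎_; inj₁; inj₂)
open import Data.Vec using (Vec; tabulate)
import Data.Vec as Vec
open import Data.Vec.Properties using (lookup∘tabulate)
open import Function using (_∘_; id)
open import Function.Bundles using (Equivalence; Inverse)
open import Function.Definitions using (Injective)
open import Relation.Binary.Definitions using (Symmetric)
open import Relation.Binary.PropositionalEquality using (_≡_; _≢_; refl; sym; trans; cong; cong₂; subst; subst₂; setoid; module ≡-Reasoning)
open import Relation.Nullary using (¬_; Dec; yes; no; does; ¬?)
open import Relation.Nullary.Decidable using (T?; _×-dec_; _⊎-dec_; toWitness)

witness-or-all : ∀ {n} {A : Set} {B : Fin n → Set} → (∀ j → A ⊎ B j) → A ⊎ (∀ j → B j)
witness-or-all {zero}          _ = inj₂ λ ()
witness-or-all {suc n} {B = B} h with h zero | witness-or-all {B = B ∘ suc} (h ∘ suc)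
... | inj₁ a  | _        = inj₁ a
... | inj₂ _  | inj₁ a   = inj₁ a
... | inj₂ b₀ | inj₂ bₛ = inj₂ λ { zero → b₀ ; (suc j) → bₛ j }

length-concatMap : ∀ {A B : Set} {m} (f : A → List B) → (∀ x → length (f x) ≡ m) → ∀ xs → length (concatMap f xs) ≡ length xs * m
length-concatMap f f-length []       = refl
length-concatMap f f-length (x ∷ xs) = trans (length-++ (f x)) (cong₂ _+_ (f-length x) (length-concatMap f f-length xs))

inject₁≢suc : ∀ {k} (j : Fin k) → inject₁ j ≢ suc j
inject₁≢suc zero    ()
inject₁≢suc (suc j) eq = inject₁≢suc j (suc-injective eq)

unique-⊆⇒length≤ : ∀ {A : Set} {xs ys : List A} → Unique xs → (∀ {z} → z ∈ xs → z ∈ ys) → length xs ≤ length ys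
unique-⊆⇒length≤ {xs = []}     _          _   = z≤n
unique-⊆⇒length≤ {xs = x ∷ xs} (x∉ ∷ u) xs⊆ys with ∈-∃++ (xs⊆ys (here refl))
... | as , bs , refl = ℕ.≤-trans (s≤s (unique-⊆⇒length≤ u xs⊆as++bs)) (ℕ.≤-reflexive (sym length-as++x∷bs))
  where
  xs⊆as++bs : ∀ {z} → z ∈ xs → z ∈ as ++ bs
  xs⊆as++bs z∈ with ∈-++⁻ as (xs⊆ys (there z∈))
  ... | inj₁ z∈as          = ∈-++⁺ˡ z∈as
  ... | inj₂ (here refl)   = ⊥-elim (All.lookup x∉ z∈ refl)
  ... | inj₂ (there z∈bs)  = ∈-++⁺ʳ as z∈bs
  length-as++x∷bs : length (as ++ x ∷ bs) ≡ suc (length (as ++ bs))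
  length-as++x∷bs = trans (length-++ as) (trans (ℕ.+-suc _ _) (cong suc (sym (length-++ as))))

module _ {A : Set} where

  unique-lookup-injective : ∀ {xs : List A} → Unique xs → Injective _≡_ _≡_ (lookup xs)
  unique-lookup-injective (_   ∷ _) {zero}  {zero}  _  = refl
  unique-lookup-injective (x∉ ∷ _) {zero}  {suc j} eq = ⊥-elim (All.lookup x∉ (∈-lookup j) eq)
  unique-lookup-injective (x∉ ∷ _) {suc i} {zero}  eq = ⊥-elim (All.lookup x∉ (∈-lookup i) (sym eq))
  unique-lookup-injective (_   ∷ u) {suc i} {suc j} eq = cong suc (unique-lookup-injective u eq)

  unique-++⁻ˡ : ∀ xs {ys : List A} → Unique (xs ++ ys) → Unique xs
  unique-++⁻ˡ []       _         = []
  unique-++⁻ˡ (x ∷ xs) (x∉ ∷ u) = All.++⁻ˡ xs x∉ ∷ unique-++⁻ˡ xs u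

  unique-∷ʳ⇒∉ : ∀ xs {y : A} → Unique (xs ++ [ y ]) → y ∉ xs
  unique-∷ʳ⇒∉ (x ∷ xs) (x∉ ∷ _) (here refl) = All.lookup x∉ (∈-++⁺ʳ xs (here refl)) refl
  unique-∷ʳ⇒∉ (x ∷ xs) (_  ∷ u) (there y∈) = unique-∷ʳ⇒∉ xs u y∈

  unique-wrap : ∀ {x y : A} {zs} → Unique zs → x ∉ zs → y ∉ zs → x ≢ y → Unique (x ∷ zs ++ [ y ])
  unique-wrap {x} {y} {zs} u x∉ y∉ x≢y =
    All.tabulate x∉zs∷ʳy ∷ Unique.++⁺ u ([] ∷ []) λ { (y∈ , here refl) → y∉ y∈ }
    where
    x∉zs∷ʳy : ∀ {z} → z ∈ zs ++ [ y ] → x ≢ z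
    x∉zs∷ʳy z∈ refl with ∈-++⁻ zs z∈
    ... | inj₁ x∈         = x∉ x∈
    ... | inj₂ (here refl) = x≢y refl

module _ {A : Set} {R : A → A → Set} where

  linked-lookup : ∀ {xs : List A} → Linked R xs → ∀ {i j} → suc (toℕ i) ≡ toℕ j → R (lookup xs i) (lookup xs j)
  linked-lookup (r ∷ _)  {zero}  {suc zero} refl = r
  linked-lookup (_ ∷ rs) {suc i} {suc j}    eq   = linked-lookup rs (ℕ.suc-injective eq)

  linked-++⁻ˡ : ∀ xs {ys : List A} → Linked R (xs ++ ys) → Linked R xs
  linked-++⁻ˡ []           _        = []
  linked-++⁻ˡ (x ∷ [])     _        = [-]
  linked-++⁻ˡ (x ∷ y ∷ xs) (r ∷ rs) = r ∷ linked-++⁻ˡ (y ∷ xs) rs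

  linked-lookup-last : ∀ xs {y : A} → Linked R (xs ++ [ y ]) →
                       ∀ i → suc (toℕ i) ≡ length xs → R (lookup xs i) y
  linked-lookup-last (x ∷ [])     (r ∷ _)  zero    refl = r
  linked-lookup-last (x ∷ z ∷ xs) (_ ∷ rs) (suc i) eq   = linked-lookup-last (z ∷ xs) rs i (ℕ.suc-injective eq)

  linked-glue : ∀ xs {y : A} {ys} → Linked R (xs ++ [ y ]) → Linked R (y ∷ ys) → Linked R (xs ++ y ∷ ys)
  linked-glue []           _        l = l
  linked-glue (x ∷ [])     (r ∷ _)  l = r ∷ l
  linked-glue (x ∷ z ∷ xs) (r ∷ rs) l = r ∷ linked-glue (z ∷ xs) rs l

  linked-snoc : ∀ xs {y z : A} → Linked R (xs ++ [ y ]) → R y z → Linked R ((xs ++ [ y ]) ++ [ z ])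
  linked-snoc xs l r = subst (Linked R) (sym (++-assoc xs _ _)) (linked-glue xs l (r ∷ [-]))

  linked-reverse : Symmetric R → ∀ {xs} → Linked R xs → Linked R (reverse xs)
  linked-reverse R-sym []         = []
  linked-reverse R-sym {x ∷ xs} l = onto l [-]
    where
    onto : ∀ {x ys zs} → Linked R (x ∷ ys) → Linked R (x ∷ zs) → Linked R (reverseAcc (x ∷ zs) ys)
    onto [-]      acc = acc
    onto (r ∷ rs) acc = onto rs (R-sym r ∷ acc)

-- Paths and cycles as lists

Cycle : {A : Set} → (A → A → Set) → ℕ → Set
Cycle {A} R n = Σ (Fin n → A) λ f → Injective _≡_ _≡_ f × (∀ i j → CycleStep i j → R (f i) (f j))

module _ {A : Set} {R : A → A → Set} where

  closedWalk⇒cycle : ∀ {x : A} xs → Linked R (x ∷ xs ++ [ x ]) → Unique (x ∷ xs) → Cycle R (suc (length xs))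
  closedWalk⇒cycle {x} xs walk u = lookup (x ∷ xs) , unique-lookup-injective u , step
    where
    step : ∀ i j → CycleStep i j → R (lookup (x ∷ xs) i) (lookup (x ∷ xs) j)
    step i j    (inj₁ i+1≡j)       = linked-lookup (linked-++⁻ˡ (x ∷ xs) walk) i+1≡j
    step i zero (inj₂ (i+1≡n , _)) = linked-lookup-last (x ∷ xs) walk i i+1≡n

record Path {A : Set} (R : A → A → Set) (Q : A → Set) (ℓ : ℕ) (x y : A) : Set where
  field
    interior : List A
    linked   : Linked R (x ∷ interior ++ [ y ])
    unique   : Unique (x ∷ interior ++ [ y ])
    size     : length interior ≡ ℓ
    within   : All Q interior

module _ {A : Set} {R : A → A → Set} where
  open Path

  Path-reverse : ∀ {Q ℓ x y} → Symmetric R → Path R Q ℓ x y → Path R Q ℓ y x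
  Path-reverse {x = x} {y} R-sym p = record
    { interior = reverse (interior p)
    ; linked   = subst (Linked R) reversed (linked-reverse R-sym (linked p))
    ; unique   = subst Unique reversed
                   (Permutation.Unique-resp-↭ (setoid A) (↭⇒↭ₛ (↭-sym (↭-reverse _))) (unique p))
    ; size     = trans (length-reverse (interior p)) (size p)
    ; within   = All-resp-↭ (↭-sym (↭-reverse (interior p))) (within p)
    }
    where
    reversed : reverse (x ∷ interior p ++ [ y ]) ≡ y ∷ reverse (interior p) ++ [ x ]
    reversed = trans (unfold-reverse x (interior p ++ [ y ])) (cong (_++ [ x ]) (reverse-++ (interior p) [ y ]))

  Path-mono : ∀ {Q Q′ : A → Set} {ℓ x y} → (∀ {z} → Q z → Q′ z) → Path R Q ℓ x y → Path R Q′ ℓ x y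
  Path-mono Q⊆Q′ p = record { Path p ; within = All.map Q⊆Q′ (within p) }

  Path-extend : ∀ {Q Q′ : A → Set} {ℓ x y x′ y′} → (∀ {z} → Q z → Q′ z) → Q′ x′ → Q′ y′ →
                ¬ Q′ x → ¬ Q′ y → x ≢ y → R x x′ → R y′ y → Path R Q ℓ x′ y′ → Path R Q′ (2 + ℓ) x y
  Path-extend {Q′ = Q′} {x = x} {y} {x′} {y′} Q⊆Q′ x′∈Q′ y′∈Q′ x∉Q′ y∉Q′ x≢y xx′ y′y p = record
    { interior = x′ ∷ interior p ++ [ y′ ]
    ; linked   = xx′ ∷ linked-snoc (x′ ∷ interior p) (linked p) y′y
    ; unique   = unique-wrap (unique p) (outside x∉Q′) (outside y∉Q′) x≢y
    ; size     = cong suc (trans (length-++ (interior p)) (trans (ℕ.+-comm _ 1) (cong suc (size p))))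
    ; within   = vertices-in-Q′
    }
    where
    vertices-in-Q′ : All Q′ (x′ ∷ interior p ++ [ y′ ])
    vertices-in-Q′ = x′∈Q′ ∷ All.++⁺ (All.map Q⊆Q′ (within p)) (y′∈Q′ ∷ [])
    outside : ∀ {z} → ¬ Q′ z → z ∉ x′ ∷ interior p ++ [ y′ ]
    outside z∉Q′ z∈ = z∉Q′ (All.lookup vertices-in-Q′ z∈)

  Path-join : ∀ {Q Q′ : A → Set} {ℓ ℓ′ x y} → (∀ {z} → Q z → ¬ Q′ z) →
              Path R Q ℓ x y → Path R Q′ ℓ′ y x → Cycle R (2 + ℓ + ℓ′)
  Path-join {ℓ = ℓ} {ℓ′} {x} {y} Q∩Q′=∅ p q = subst (Cycle R) cycle-length (closedWalk⇒cycle (I ++ y ∷ J) walk distinct)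
    where
    I J : List A
    I = interior p
    J = interior q
    y∉J : y ∉ J
    y∉J y∈J with unique q
    ... | y∉ ∷ _ = All.lookup y∉ (∈-++⁺ˡ y∈J) refl
    x∉J : x ∉ J
    x∉J with unique q
    ... | _ ∷ u = unique-∷ʳ⇒∉ J u
    unique-J : Unique J
    unique-J with unique q
    ... | _ ∷ u = unique-++⁻ˡ J u
    walk : Linked R (x ∷ (I ++ y ∷ J) ++ [ x ])
    walk = subst (λ zs → Linked R (x ∷ zs)) (sym (++-assoc I (y ∷ J) [ x ])) (linked-glue (x ∷ I) (linked p) (linked q))
    distinct : Unique (x ∷ I ++ y ∷ J)
    distinct = subst Unique (++-assoc (x ∷ I) [ y ] J) (Unique.++⁺ (unique p) unique-J disjoint)
      where
      disjoint : ∀ {z} → z ∈ x ∷ I ++ [ y ] × z ∈ J → ⊥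
      disjoint (here refl , x∈J) = x∉J x∈J
      disjoint (there z∈ , z∈J) with ∈-++⁻ I z∈
      ... | inj₁ z∈I        = Q∩Q′=∅ (All.lookup (within p) z∈I) (All.lookup (within q) z∈J)
      ... | inj₂ (here refl) = y∉J z∈J
    cycle-length : suc (length (I ++ y ∷ J)) ≡ 2 + ℓ + ℓ′
    cycle-length = cong suc (trans (length-++ I) (trans (cong₂ _+_ (size p) (cong suc (size q))) (ℕ.+-suc ℓ ℓ′)))

module _ {N : ℕ} where

  private
    _∈?_ : (e : Fin N × Fin N) (E : List (Fin N × Fin N)) → Dec (e ∈ E)
    _∈?_ = DecMembership._∈?_ (≡-dec _≟_ _≟_)

  fromEdges : List (Fin N × Fin N) → Graph N
  fromEdges E = record
    { adj    = adjacent
    ; sym    = adjacent-sym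
    ; irrefl = adjacent-irrefl
    }
    where
    adjacent : Fin N → Fin N → Bool
    adjacent u v = not (does (u ≟ v)) ∧ (does ((u , v) ∈? E) ∨ does ((v , u) ∈? E))
    adjacent-sym : ∀ u v → adjacent u v ≡ adjacent v u
    adjacent-sym u v with u ≟ v | v ≟ u
    ... | yes _   | yes _   = refl
    ... | no _    | no _    = ∨-comm (does ((u , v) ∈? E)) (does ((v , u) ∈? E))
    ... | yes u≡v | no v≢u  = ⊥-elim (v≢u (sym u≡v))
    ... | no u≢v  | yes v≡u = ⊥-elim (u≢v (sym v≡u))
    adjacent-irrefl : ∀ v → adjacent v v ≡ false
    adjacent-irrefl v with v ≟ v
    ... | yes _   = refl
    ... | no v≢v  = ⊥-elim (v≢v refl)

  module _ {E : List (Fin N × Fin N)} where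

    fromEdges-adj : ∀ {u v} → u ≢ v → (u , v) ∈ E → adj (fromEdges E) u v ≡ true
    fromEdges-adj {u} {v} u≢v uv∈E with u ≟ v | (u , v) ∈? E
    ... | yes u≡v | _       = ⊥-elim (u≢v u≡v)
    ... | no _    | yes _   = refl
    ... | no _    | no uv∉E = ⊥-elim (uv∉E uv∈E)

    fromEdges-adj⁻ : ∀ {u v} → T (adj (fromEdges E) u v) → (u , v) ∈ E ⊎ (v , u) ∈ E
    fromEdges-adj⁻ {u} {v} uv with u ≟ v | (u , v) ∈? E | (v , u) ∈? E
    ... | no _ | yes uv∈E | _        = inj₁ uv∈E
    ... | no _ | no _     | yes vu∈E = inj₂ vu∈E

    -- The counted pairs u < v are distinct, and each is the orientation of a listed edge.
    edgeCount-fromEdges : edgeCount (fromEdges E) ≤ length E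
    edgeCount-fromEdges = ℕ.≤-trans (unique-⊆⇒length≤ unique-pairs pairs⊆oriented) (ℕ.≤-reflexive (length-map orient E))
      where
      F = fromEdges E
      ordered-edge : Fin N × Fin N → Bool
      ordered-edge (u , v) = (toℕ u <ᵇ toℕ v) ∧ adj F u v
      orient : Fin N × Fin N → Fin N × Fin N
      orient (u , v) = if toℕ u <ᵇ toℕ v then (u , v) else (v , u)
      orient-< : ∀ {u v} → T (toℕ u <ᵇ toℕ v) → orient (u , v) ≡ (u , v)
      orient-< {u} {v} u<v with toℕ u <ᵇ toℕ v
      ... | true = refl
      orient-> : ∀ {u v} → T (toℕ u <ᵇ toℕ v) → orient (v , u) ≡ (u , v)
      orient-> {u} {v} u<v with toℕ v <ᵇ toℕ u in v<u
      ... | false = refl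
      ... | true  = ⊥-elim (ℕ.<-asym (ℕ.<ᵇ⇒< (toℕ u) (toℕ v) u<v) (ℕ.<ᵇ⇒< (toℕ v) (toℕ u) (subst T (sym v<u) _)))
      unique-pairs : Unique (filterᵇ ordered-edge (cartesianProduct (allFin N) (allFin N)))
      unique-pairs = Unique.filter⁺ (T? ∘ ordered-edge) (Unique.cartesianProduct⁺ (Unique.allFin⁺ N) (Unique.allFin⁺ N))
      pairs⊆oriented : ∀ {e} → e ∈ filterᵇ ordered-edge (cartesianProduct (allFin N) (allFin N)) → e ∈ map orient E
      pairs⊆oriented {u , v} e∈ with Equivalence.to T-∧ (proj₂ (∈-filter⁻ (T? ∘ ordered-edge) {xs = cartesianProduct (allFin N) (allFin N)} e∈))
      ... | u<v , uv with fromEdges-adj⁻ uv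
      ...   | inj₁ uv∈E = subst (_∈ map orient E) (orient-< u<v) (∈-map⁺ orient uv∈E)
      ...   | inj₂ vu∈E = subst (_∈ map orient E) (orient-> u<v) (∈-map⁺ orient vu∈E)

<⇒¬ArrowsP3Cycle : ∀ {M n} → M < n → (F : Graph M) → ¬ ArrowsP3Cycle F n
<⇒¬ArrowsP3Cycle M<n F arrows with arrows (record { col = λ _ _ → blue ; colSym = λ _ _ → refl })
... | inj₁ (_ , _ , _ , _ , _ , _ , (_ , ()) , _)
... | inj₂ (f , f-injective , _) with pigeonhole M<n f
...   | i , j , i<j , fi≡fj = ℕ.<⇒≢ i<j (cong toℕ (f-injective fi≡fj))

PerfectMatching : {A : Set} → (A → A → Set) → (Bool → A) → (Bool → A) → Set
PerfectMatching R u v = Σ Bool λ σ → ∀ s → R (u s) (v (s xor σ))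

module ColouredEdges {N} {F : Graph N} {c : Colouring F} where

  ColEdge-sym : ∀ {k u v} → ColEdge F c k u v → ColEdge F c k v u
  ColEdge-sym {u = u} {v} (uv , uv-colour) = trans (Defs.sym F v u) uv , trans (colSym c v u) uv-colour

  ColEdge⇒≢ : ∀ {k u v} → ColEdge F c k u v → u ≢ v
  ColEdge⇒≢ {u = u} (uu , _) refl with trans (sym uu) (irrefl F u)
  ... | ()

  redCherry : ∀ {a b d} → ColEdge F c red a b → ColEdge F c red b d → a ≢ d → HasMonoP3 F c red
  redCherry ab bd a≢d = _ , _ , _ , ColEdge⇒≢ ab , ColEdge⇒≢ bd , a≢d , ab , bd

  -- A straight edge (s, s) and a crossed edge (s, not s) always share an endpoint.
  K₂₂-redP3-or-blueMatching : ∀ (u v : Bool → Fin N) → u false ≢ u true → v false ≢ v true →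
                              (∀ s t → adj F (u s) (v t) ≡ true) →
                              HasMonoP3 F c red ⊎ PerfectMatching (ColEdge F c blue) u v
  K₂₂-redP3-or-blueMatching u v u≢ v≢ edge
    with col c (u false) (v false) in e₀₀ | col c (u true) (v true) in e₁₁
       | col c (u false) (v true)  in e₀₁ | col c (u true) (v false) in e₁₀
  ... | blue | blue | _    | _    = inj₂ (false , λ { false → edge false false , e₀₀ ; true → edge true true , e₁₁ })
  ... | _    | _    | blue | blue = inj₂ (true  , λ { false → edge false true  , e₀₁ ; true → edge true false , e₁₀ })
  ... | red  | _    | red  | _    = inj₁ (redCherry (ColEdge-sym (edge false false , e₀₀)) (edge false true , e₀₁) v≢)
  ... | red  | _    | blue | red  = inj₁ (redCherry (edge false false , e₀₀) (ColEdge-sym (edge true false , e₁₀)) u≢)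
  ... | blue | red  | red  | _    = inj₁ (redCherry (edge true true , e₁₁) (ColEdge-sym (edge false true , e₀₁)) (u≢ ∘ sym))
  ... | blue | red  | blue | red  = inj₁ (redCherry (ColEdge-sym (edge true true , e₁₁)) (edge true false , e₁₀) (v≢ ∘ sym))

-- The gadget is K₄,₃ minus the edge {1, 6} on Fin 7: the sides are 0–3 and 4–6, the rung is
-- attached at 0 and 1, and 2–6 are the private vertices.  A gadget colouring assigns a colour to
-- each pair (α, β) of the two sides (that of the non-edge is ignored).
GadgetColouring : Set
GadgetColouring = Vec (Vec Colour 3) 4

isEdge : Fin 4 → Fin 3 → Bool
isEdge 1F 2F = false
isEdge _  _  = true

bipartiteEdge : Fin 4 × Fin 3 → Fin 7 × Fin 7
bipartiteEdge (α , β) = α ↑ˡ 3 , 4 ↑ʳ β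

gadgetEdges : List (Fin 7 × Fin 7)
gadgetEdges = map bipartiteEdge (filterᵇ (uncurry isEdge) (cartesianProduct (allFin 4) (allFin 3)))

isEdge⇒∈gadgetEdges : ∀ α β → T (isEdge α β) → (α ↑ˡ 3 , 4 ↑ʳ β) ∈ gadgetEdges
isEdge⇒∈gadgetEdges α β αβ =
  ∈-map⁺ bipartiteEdge (∈-filter⁺ (T? ∘ uncurry isEdge) (∈-cartesianProduct⁺ (∈-allFin α) (∈-allFin β)) αβ)

_≟ᶜ_ : (k l : Colour) → Dec (k ≡ l)
red  ≟ᶜ red  = yes refl
red  ≟ᶜ blue = no λ ()
blue ≟ᶜ red  = no λ ()
blue ≟ᶜ blue = yes refl

EdgeOf : GadgetColouring → Colour → Fin 4 → Fin 3 → Set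
EdgeOf κ k α β = T (isEdge α β) × Vec.lookup (Vec.lookup κ α) β ≡ k

Coloured : GadgetColouring → Colour → Fin 7 → Fin 7 → Set
Coloured κ k u v with splitAt 4 u | splitAt 4 v
... | inj₁ α | inj₂ β = EdgeOf κ k α β
... | inj₂ β | inj₁ α = EdgeOf κ k α β
... | _      | _      = ⊥

coloured? : ∀ κ k u v → Dec (Coloured κ k u v)
coloured? κ k u v with splitAt 4 u | splitAt 4 v
... | inj₁ α | inj₂ β = T? (isEdge α β) ×-dec (Vec.lookup (Vec.lookup κ α) β ≟ᶜ k)
... | inj₂ β | inj₁ α = T? (isEdge α β) ×-dec (Vec.lookup (Vec.lookup κ α) β ≟ᶜ k)
... | inj₁ _ | inj₁ _ = no λ ()
... | inj₂ _ | inj₂ _ = no λ ()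

-- Certificates for the exhaustive check: the paths u v w of the gadget, and the interiors of
-- its Hamiltonian paths from 0 to 1.
cherries : List (Fin 7 × Fin 7 × Fin 7)
cherries =
  (4F , 0F , 5F) ∷ (4F , 0F , 6F) ∷ (5F , 0F , 6F) ∷ (4F , 1F , 5F) ∷
  (4F , 2F , 5F) ∷ (4F , 2F , 6F) ∷ (5F , 2F , 6F) ∷
  (4F , 3F , 5F) ∷ (4F , 3F , 6F) ∷ (5F , 3F , 6F) ∷
  (0F , 4F , 1F) ∷ (0F , 4F , 2F) ∷ (0F , 4F , 3F) ∷ (1F , 4F , 2F) ∷ (1F , 4F , 3F) ∷ (2F , 4F , 3F) ∷
  (0F , 5F , 1F) ∷ (0F , 5F , 2F) ∷ (0F , 5F , 3F) ∷ (1F , 5F , 2F) ∷ (1F , 5F , 3F) ∷ (2F , 5F , 3F) ∷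
  (0F , 6F , 2F) ∷ (0F , 6F , 3F) ∷ (2F , 6F , 3F) ∷ []

routes : List (List (Fin 7))
routes =
  (5F ∷ 2F ∷ 6F ∷ 3F ∷ 4F ∷ []) ∷ (5F ∷ 3F ∷ 6F ∷ 2F ∷ 4F ∷ []) ∷
  (6F ∷ 2F ∷ 5F ∷ 3F ∷ 4F ∷ []) ∷ (6F ∷ 3F ∷ 5F ∷ 2F ∷ 4F ∷ []) ∷
  (4F ∷ 2F ∷ 6F ∷ 3F ∷ 5F ∷ []) ∷ (4F ∷ 3F ∷ 6F ∷ 2F ∷ 5F ∷ []) ∷
  (6F ∷ 2F ∷ 4F ∷ 3F ∷ 5F ∷ []) ∷ (6F ∷ 3F ∷ 4F ∷ 2F ∷ 5F ∷ []) ∷ []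

RedCherry : GadgetColouring → Fin 7 × Fin 7 × Fin 7 → Set
RedCherry κ (u , v , w) = u ≢ w × Coloured κ red u v × Coloured κ red v w

BlueRoute : GadgetColouring → List (Fin 7) → Set
BlueRoute κ I = Linked (Coloured κ blue) (0F ∷ I ++ [ 1F ]) × Unique (0F ∷ I ++ [ 1F ]) × length I ≡ 5

Certified : GadgetColouring → Set
Certified κ = Any (RedCherry κ) cherries ⊎ Any (BlueRoute κ) routes

certified? : ∀ κ → Dec (Certified κ)
certified? κ = Any.any? (λ (u , v , w) → ¬? (u ≟ w) ×-dec coloured? κ red u v ×-dec coloured? κ red v w) cherries
       ⊎-dec Any.any? (λ I → linked? (coloured? κ blue) _ ×-dec unique? _ ×-dec (length I ℕ.≟ 5)) routes

vectors : ∀ {A : Set} → List A → ∀ n → List (Vec A n)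
vectors xs zero    = Vec.[] ∷ []
vectors xs (suc n) = cartesianProductWith Vec._∷_ xs (vectors xs n)

∈-vectors : ∀ {A : Set} {xs : List A} → (∀ x → x ∈ xs) → ∀ {n} (v : Vec A n) → v ∈ vectors xs n
∈-vectors every Vec.[]       = here refl
∈-vectors every (x Vec.∷ v) = ∈-cartesianProductWith⁺ Vec._∷_ (every x) (∈-vectors every v)

∈-colours : ∀ k → k ∈ red ∷ blue ∷ []
∈-colours red  = here refl
∈-colours blue = there (here refl)

colourings : List GadgetColouring
colourings = vectors (vectors (red ∷ blue ∷ []) 3) 4

∈-colourings : ∀ κ → κ ∈ colourings
∈-colourings = ∈-vectors (∈-vectors ∈-colours)

gadgetEdge⇒≢ : ∀ {u v} → (u , v) ∈ gadgetEdges → u ≢ v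
gadgetEdge⇒≢ = All.lookup (toWitness {a? = All.all? (λ e → ¬? (proj₁ e ≟ proj₂ e)) gadgetEdges} _)

-- Opaque, so that case analysis on its entries never unfolds the 4096-case decision procedure.
opaque
  every-colouring-certified : All Certified colourings
  every-colouring-certified = toWitness {a? = All.all? certified? colourings} _

GadgetInterior : ∀ {N} → (Fin 7 → Fin N) → Fin N → Set
GadgetInterior g z = Σ (Fin 5) λ i → z ≡ g (2 ↑ʳ i)

module _ {N} {F : Graph N} {c : Colouring F} {g : Fin 7 → Fin N} (g-injective : Injective _≡_ _≡_ g)
         (g-edges : ∀ {u v} → (u , v) ∈ gadgetEdges → adj F (g u) (g v) ≡ true) where

  open ColouredEdges {F = F} {c}

  private
    colourOf : Fin 4 → Fin 3 → Colour
    colourOf α β = col c (g (α ↑ˡ 3)) (g (4 ↑ʳ β))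

    κ : GadgetColouring
    κ = tabulate λ α → tabulate (colourOf α)

    edge : ∀ {k} α β → EdgeOf κ k α β → ColEdge F c k (g (α ↑ˡ 3)) (g (4 ↑ʳ β))
    edge α β (αβ , κ≡k) = g-edges (isEdge⇒∈gadgetEdges α β αβ) , trans (sym κ-entry) κ≡k
      where
      κ-entry : Vec.lookup (Vec.lookup κ α) β ≡ colourOf α β
      κ-entry = trans (cong (λ row → Vec.lookup row β) (lookup∘tabulate (tabulate ∘ colourOf) α)) (lookup∘tabulate (colourOf α) β)

    coloured⇒ColEdge : ∀ {k} u v → Coloured κ k u v → ColEdge F c k (g u) (g v)
    coloured⇒ColEdge {k} u v with splitAt 4 u in eqᵤ | splitAt 4 v in eqᵥ
    ... | inj₁ α | inj₂ β = subst₂ (ColEdge F c k) (cong g (splitAt⁻¹-↑ˡ eqᵤ)) (cong g (splitAt⁻¹-↑ʳ eqᵥ)) ∘ edge α β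
    ... | inj₂ β | inj₁ α =
      ColEdge-sym ∘ subst₂ (ColEdge F c k) (cong g (splitAt⁻¹-↑ˡ eqᵥ)) (cong g (splitAt⁻¹-↑ʳ eqᵤ)) ∘ edge α β
    ... | inj₁ _ | inj₁ _ = λ ()
    ... | inj₂ _ | inj₂ _ = λ ()

    route⇒Path : ∀ I → BlueRoute κ I → Path (ColEdge F c blue) (GadgetInterior g) 5 (g 0F) (g 1F)
    route⇒Path I (blue-walk , distinct@(0∉ ∷ distinct′) , size) = record
      { interior = map g I
      ; linked   = subst (Linked _) map-route (Linked.map⁺ (Linked.map (λ {u} {v} → coloured⇒ColEdge u v) blue-walk))
      ; unique   = subst Unique map-route (Unique.map⁺ g-injective distinct)
      ; size     = trans (length-map g I) size
      ; within   = All.map⁺ (All.tabulate λ {w} w∈I → Product.map₂ (cong g) (non-port w (0≢ w∈I) (1≢ w∈I)))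
      }
      where
      map-route : map g (0F ∷ I ++ [ 1F ]) ≡ g 0F ∷ map g I ++ [ g 1F ]
      map-route = cong (g 0F ∷_) (map-++ g I [ 1F ])
      0≢ : ∀ {w} → w ∈ I → w ≢ 0F
      0≢ w∈I w≡0 = All.lookup 0∉ (∈-++⁺ˡ w∈I) (sym w≡0)
      1≢ : ∀ {w} → w ∈ I → w ≢ 1F
      1≢ w∈I refl = unique-∷ʳ⇒∉ I distinct′ w∈I
      non-port : ∀ w → w ≢ 0F → w ≢ 1F → Σ (Fin 5) λ i → w ≡ 2 ↑ʳ i
      non-port 0F            w≢0 _   = ⊥-elim (w≢0 refl)
      non-port 1F            _   w≢1 = ⊥-elim (w≢1 refl)
      non-port (suc (suc i)) _   _   = i , refl

  gadget-redP3-or-bluePath : HasMonoP3 F c red ⊎ Path (ColEdge F c blue) (GadgetInterior g) 5 (g 0F) (g 1F)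
  gadget-redP3-or-bluePath with All.lookup every-colouring-certified (∈-colourings κ)
  ... | inj₁ cherry with Any.satisfied cherry
  ...   | (u , v , w) , u≢w , uv , vw =
          inj₁ (redCherry (coloured⇒ColEdge u v uv) (coloured⇒ColEdge v w vw) (u≢w ∘ g-injective))
  gadget-redP3-or-bluePath | inj₂ route with Any.satisfied route
  ...   | I , blue-route = inj₂ (route⇒Path I blue-route)

-- The ladder

LadderInterior : ∀ {A : Set} {k} → (A → Set) → (Fin (suc k) → Bool → A) → A → Set
LadderInterior {k = k} E r z = (Σ (Fin k) λ i → Σ Bool λ s → z ≡ r (suc i) s) ⊎ E z

module _ {A : Set} {R : A → A → Set} (R-sym : Symmetric R) {E : A → Set} where

  ladder-path : ∀ k (r : Fin (suc k) → Bool → A) →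
                (∀ {i s j t} → r i s ≡ r j t → i ≡ j × s ≡ t) → (∀ i s → ¬ E (r i s)) →
                (∀ (j : Fin k) → PerfectMatching R (r (inject₁ j)) (r (suc j))) →
                (∀ b → Path R E 5 (r (fromℕ k) b) (r (fromℕ k) (not b))) →
                ∀ b → Path R (LadderInterior E r) (k * 2 + 5) (r zero b) (r zero (not b))
  ladder-path zero    r _           _   _        end b = Path-mono inj₂ (end b)
  ladder-path (suc k) r r-injective r∉E matching end b =
    Path-extend next-rungs (inj₁ (zero , b′ , refl)) (inj₁ (zero , not b′ , refl))
                first-rung∉ first-rung∉ (not-¬ refl ∘ proj₂ ∘ r-injective)
                (proj₂ (matching zero) b) back
                (ladder-path k (r ∘ suc) (Product.map₁ suc-injective ∘ r-injective) (r∉E ∘ suc) (matching ∘ suc) end b′)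
    where
    σ b′ : Bool
    σ  = proj₁ (matching zero)
    b′ = b xor σ
    back : R (r (suc zero) (not b′)) (r zero (not b))
    back = R-sym (subst (R (r zero (not b)) ∘ r (suc zero)) (sym (not-distribˡ-xor b σ)) (proj₂ (matching zero) (not b)))
    next-rungs : ∀ {z} → LadderInterior E (r ∘ suc) z → LadderInterior E r z
    next-rungs (inj₁ (i , s , z≡r)) = inj₁ (suc i , s , z≡r)
    next-rungs (inj₂ z∈E)          = inj₂ z∈E
    first-rung∉ : ∀ {s} → ¬ LadderInterior E r (r zero s)
    first-rung∉ (inj₁ (i , s , r₀≡r)) with () ← proj₁ (r-injective r₀≡r)
    first-rung∉ (inj₂ r₀∈E)          = r∉E zero _ r₀∈E

-- The graph F

data Vertex (k : ℕ) : Set where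
  rung       : Fin (suc k) → Bool → Vertex k
  left right : Fin 5 → Vertex k

rung-injective : ∀ {k i j s t} → rung {k} i s ≡ rung j t → i ≡ j × s ≡ t
rung-injective refl = refl , refl

module Construction (k : ℕ) where

  order : ℕ
  order = 12 + k * 2

  encode : Vertex k → Fin order
  encode (left i)   = i ↑ˡ (5 + suc k * 2)
  encode (right i)  = 5 ↑ʳ (i ↑ˡ suc k * 2)
  encode (rung j b) = 5 ↑ʳ (5 ↑ʳ combine j (Inverse.from 2↔Bool b))

  decodeRung : Fin (suc k) × Fin 2 → Vertex k
  decodeRung (j , b) = rung j (Inverse.to 2↔Bool b)

  decode : Fin order → Vertex k
  decode x with splitAt 5 x
  ... | inj₁ i = left i
  ... | inj₂ y with splitAt 5 y
  ...   | inj₁ i = right i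
  ...   | inj₂ z = decodeRung (remQuot 2 z)

  decode-encode : ∀ v → decode (encode v) ≡ v
  decode-encode (left i)   rewrite splitAt-↑ˡ 5 i (5 + suc k * 2) = refl
  decode-encode (right i)  rewrite splitAt-↑ʳ 5 (5 + suc k * 2) (i ↑ˡ suc k * 2) | splitAt-↑ˡ 5 i (suc k * 2) = refl
  decode-encode (rung j b)
    rewrite splitAt-↑ʳ 5 (5 + suc k * 2) (5 ↑ʳ combine j (Inverse.from 2↔Bool b))
          | splitAt-↑ʳ 5 (suc k * 2) (combine j (Inverse.from 2↔Bool b))
          = trans (cong decodeRung (remQuot-combine j (Inverse.from 2↔Bool b))) (cong (rung j) (Inverse.strictlyInverseˡ 2↔Bool b))

  encode-injective : Injective _≡_ _≡_ encode
  encode-injective {u} {v} eq = trans (sym (decode-encode u)) (trans (cong decode eq) (decode-encode v))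

  gadgetAt : Fin (suc k) → (Fin 5 → Vertex k) → Fin 7 → Vertex k
  gadgetAt j ι 0F            = rung j false
  gadgetAt j ι 1F            = rung j true
  gadgetAt j ι (suc (suc i)) = ι i

  gadgetAt-injective : ∀ {j ι} → Injective _≡_ _≡_ ι → (∀ {i b} → ι i ≢ rung j b) → Injective _≡_ _≡_ (gadgetAt j ι)
  gadgetAt-injective ι-injective ι≢rung {0F}          {0F}           _  = refl
  gadgetAt-injective ι-injective ι≢rung {1F}          {1F}           _  = refl
  gadgetAt-injective ι-injective ι≢rung {suc (suc i)} {suc (suc i′)} eq = cong (λ i → suc (suc i)) (ι-injective eq)
  gadgetAt-injective ι-injective ι≢rung {0F}          {suc (suc _)}  eq = ⊥-elim (ι≢rung (sym eq))
  gadgetAt-injective ι-injective ι≢rung {1F}          {suc (suc _)}  eq = ⊥-elim (ι≢rung (sym eq))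
  gadgetAt-injective ι-injective ι≢rung {suc (suc _)} {0F}           eq = ⊥-elim (ι≢rung eq)
  gadgetAt-injective ι-injective ι≢rung {suc (suc _)} {1F}           eq = ⊥-elim (ι≢rung eq)

  leftGadget rightGadget : Fin 7 → Vertex k
  leftGadget  = gadgetAt zero left
  rightGadget = gadgetAt (fromℕ k) right

  encode∘-injective : ∀ {A : Set} {h : A → Vertex k} → Injective _≡_ _≡_ h → Injective _≡_ _≡_ (encode ∘ h)
  encode∘-injective {h = h} h-injective {u} {v} = h-injective ∘ encode-injective {h u} {h v}

  leftGadget-injective : Injective _≡_ _≡_ leftGadget
  leftGadget-injective = gadgetAt-injective (λ { refl → refl }) (λ ())

  rightGadget-injective : Injective _≡_ _≡_ rightGadget
  rightGadget-injective = gadgetAt-injective (λ { refl → refl }) (λ ())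

  squareEdge : Fin k → Bool → Bool → Vertex k × Vertex k
  squareEdge j s t = rung (inject₁ j) s , rung (suc j) t

  squareEdges : Fin k → List (Vertex k × Vertex k)
  squareEdges j = cartesianProductWith (squareEdge j) (false ∷ true ∷ []) (false ∷ true ∷ [])

  leftEdges rightEdges ladderEdges edges : List (Vertex k × Vertex k)
  leftEdges   = map (Product.map leftGadget leftGadget) gadgetEdges
  rightEdges  = map (Product.map rightGadget rightGadget) gadgetEdges
  ladderEdges = concatMap squareEdges (allFin k)
  edges       = leftEdges ++ rightEdges ++ ladderEdges

  F : Graph order
  F = fromEdges (map (Product.map encode encode) edges)

  edges⇒adj : ∀ {u v} → u ≢ v → (u , v) ∈ edges → adj F (encode u) (encode v) ≡ true
  edges⇒adj u≢v uv∈ = fromEdges-adj (u≢v ∘ encode-injective) (∈-map⁺ (Product.map encode encode) uv∈)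

  edgeCount-F : edgeCount F ≤ 2 * order ∸ 2
  edgeCount-F = ℕ.≤-trans (edgeCount-fromEdges {E = map (Product.map encode encode) edges})
                          (ℕ.≤-reflexive (trans (length-map (Product.map encode encode) edges) edges-length))
    where
    edges-length : length edges ≡ 2 * order ∸ 2
    edges-length = begin
      length edges
        ≡⟨ length-++ leftEdges {rightEdges ++ ladderEdges} ⟩
      length leftEdges + length (rightEdges ++ ladderEdges)
        ≡⟨ cong (length leftEdges +_) (length-++ rightEdges {ladderEdges}) ⟩
      length leftEdges + (length rightEdges + length ladderEdges)
        ≡⟨ cong₂ _+_ (length-map (Product.map leftGadget leftGadget) gadgetEdges)
                     (cong₂ _+_ (length-map (Product.map rightGadget rightGadget) gadgetEdges) ladder-length) ⟩
      22 + k * 4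
        ≡⟨ sym (ℕ.m+n∸m≡n 2 (22 + k * 4)) ⟩
      2 + (22 + k * 4) ∸ 2
        ≡⟨ cong (_∸ 2) (budget k) ⟩
      2 * order ∸ 2 ∎
      where
      open ≡-Reasoning
      ladder-length : length ladderEdges ≡ k * 4
      ladder-length = trans (length-concatMap squareEdges (λ _ → refl) (allFin k)) (cong (_* 4) (length-tabulate {n = k} id))
      budget : ∀ k → 2 + (22 + k * 4) ≡ 2 * (12 + k * 2)
      budget = solve-∀

  LeftInterior RightInterior : Fin order → Set
  LeftInterior  = GadgetInterior (encode ∘ leftGadget)
  RightInterior = GadgetInterior (encode ∘ rightGadget)

  module _ (c : Colouring F) where
    open ColouredEdges {F = F} {c}

    r : Fin (suc k) → Bool → Fin order
    r j b = encode (rung j b)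

    r-injective : ∀ {i s j t} → r i s ≡ r j t → i ≡ j × s ≡ t
    r-injective {i} {s} {j} {t} = rung-injective ∘ encode-injective {rung i s} {rung j t}

    rung-ends-distinct : ∀ {j} → r j false ≢ r j true
    rung-ends-distinct {j} eq with () ← proj₂ (r-injective {j} {false} {j} {true} eq)

    square : ∀ j → HasMonoP3 F c red ⊎ PerfectMatching (ColEdge F c blue) (r (inject₁ j)) (r (suc j))
    square j = K₂₂-redP3-or-blueMatching (r (inject₁ j)) (r (suc j)) (rung-ends-distinct {inject₁ j}) (rung-ends-distinct {suc j})
                 λ s t → edges⇒adj (inject₁≢suc j ∘ proj₁ ∘ rung-injective) (square∈edges s t)
      where
      square∈edges : ∀ s t → (rung (inject₁ j) s , rung (suc j) t) ∈ edges
      square∈edges s t = ∈-++⁺ʳ leftEdges (∈-++⁺ʳ rightEdges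
        (∈-concat⁺′ (∈-cartesianProductWith⁺ (squareEdge j) (∈-bools s) (∈-bools t)) (∈-map⁺ squareEdges (∈-allFin j))))
        where
        ∈-bools : ∀ b → b ∈ false ∷ true ∷ []
        ∈-bools false = here refl
        ∈-bools true  = there (here refl)

    left-gadget : HasMonoP3 F c red ⊎ Path (ColEdge F c blue) LeftInterior 5 (r zero false) (r zero true)
    left-gadget = gadget-redP3-or-bluePath {F = F} {c} (encode∘-injective leftGadget-injective)
                    λ uv∈ → edges⇒adj (gadgetEdge⇒≢ uv∈ ∘ leftGadget-injective)
                                 (∈-++⁺ˡ (∈-map⁺ (Product.map leftGadget leftGadget) uv∈))

    right-gadget : HasMonoP3 F c red ⊎ Path (ColEdge F c blue) RightInterior 5 (r (fromℕ k) false) (r (fromℕ k) true)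
    right-gadget = gadget-redP3-or-bluePath {F = F} {c} (encode∘-injective rightGadget-injective)
                    λ uv∈ → edges⇒adj (gadgetEdge⇒≢ uv∈ ∘ rightGadget-injective)
                                 (∈-++⁺ʳ leftEdges (∈-++⁺ˡ (∈-map⁺ (Product.map rightGadget rightGadget) uv∈)))

    blueHamiltonianCycle : (∀ j → PerfectMatching (ColEdge F c blue) (r (inject₁ j)) (r (suc j))) →
                           Path (ColEdge F c blue) LeftInterior 5 (r zero false) (r zero true) →
                           Path (ColEdge F c blue) RightInterior 5 (r (fromℕ k) false) (r (fromℕ k) true) →
                           HasMonoCycle F c blue order
    blueHamiltonianCycle matching left-path right-path =
      subst (Cycle (ColEdge F c blue)) (cong (2 +_) (trans (ℕ.+-assoc (k * 2) 5 5) (ℕ.+-comm (k * 2) 10)))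
        (Path-join ladder∩left=∅ (ladder-path ColEdge-sym {E = RightInterior} k r r-injective r∉right matching right-end false)
                                 (Path-reverse ColEdge-sym left-path))
      where
      right-end : ∀ b → Path (ColEdge F c blue) RightInterior 5 (r (fromℕ k) b) (r (fromℕ k) (not b))
      right-end false = right-path
      right-end true  = Path-reverse ColEdge-sym right-path
      r∉right : ∀ i s → ¬ RightInterior (r i s)
      r∉right i s (i′ , eq) with () ← encode-injective {rung i s} {right i′} eq
      ladder∩left=∅ : ∀ {z} → LadderInterior RightInterior r z → ¬ LeftInterior z
      ladder∩left=∅ (inj₁ (i , s , refl)) (i′ , eq) with () ← encode-injective {rung (suc i) s} {left i′} eq
      ladder∩left=∅ (inj₂ (i , refl))     (i′ , eq) with () ← encode-injective {right i} {left i′} eq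

    redP3-or-blueCycle : HasMonoP3 F c red ⊎ HasMonoCycle F c blue order
    redP3-or-blueCycle with witness-or-all square | left-gadget | right-gadget
    ... | inj₁ p3       | _               | _                = inj₁ p3
    ... | inj₂ _        | inj₁ p3         | _                = inj₁ p3
    ... | inj₂ _        | inj₂ _          | inj₁ p3          = inj₁ p3
    ... | inj₂ matching | inj₂ left-path  | inj₂ right-path = inj₂ (blueHamiltonianCycle matching left-path right-path)

  arrows : ArrowsP3Cycle F order
  arrows = redP3-or-blueCycle

restricted-size-bound : ∀ k → RestrictedSizeRamseyP3Cycle≤ (12 + k * 2) (2 * (12 + k * 2) ∸ 2)
restricted-size-bound k = order , ((F , arrows) , λ _ → <⇒¬ArrowsP3Cycle) , F , arrows , edgeCount-F
  where open Construction k

theorem6 : ∀ (n : ℕ) → 2 ∣ n → 12 ≤ n → RestrictedSizeRamseyP3Cycle≤ n (2 * n ∸ 2)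
theorem6 n (divides q n≡q*2) 12≤n =
  subst (λ m → RestrictedSizeRamseyP3Cycle≤ m (2 * m ∸ 2)) (sym n≡12+k*2) (restricted-size-bound (q ∸ 6))
  where
  6≤q : 6 ≤ q
  6≤q = ℕ.*-cancelʳ-≤ 6 q 2 (subst (12 ≤_) n≡q*2 12≤n)
  n≡12+k*2 : n ≡ 12 + (q ∸ 6) * 2
  n≡12+k*2 = trans n≡q*2 (cong (_* 2) (sym (ℕ.m+[n∸m]≡n 6≤q)))
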